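{- Let $G$ be a graph with $n^2$ vertices and $H$ a graph with $m^2$ vertices, where $n\geq m$. If $O\chi(G)=n$, then $O\chi(G\,\square\, H)=nm$.
   Context: The Cartesian product $G\square H$ has vertex set $V(G)\times V(H)$, with $(u_1,v_1)$ adjacent to $(u_2,v_2)$ iff either $u_1=u_2$ and $v_1v_2\in E(H)$, or $v_1=v_2$ and $u_1u_2\in E(G)$. All colourings are proper vertex colourings. Two colourings are orthogonal if whenever two distinct vertices receive the same colour in one, they receive distinct colours in the other. An orthogonal colouring is a pair of orthogonal proper colourings; $O\chi(G)$ is the minimum number of colours needed for an orthogonal colouring of $G$ (both colourings drawing from the same set of that many colours). -}

module Defs where

open import Level using (0ℓ)
open import Data.Nat using (ℕ; _*_; _<_)
open import Data.Fin using (Fin)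
open import Data.Product using (_×_; Σ; _,_; proj₁; proj₂)
open import Data.Sum using (_⊎_)
open import Relation.Nullary using (¬_)
open import Relation.Binary.PropositionalEquality using (_≡_; _≢_)
open import Data.Fin using (combine; remQuot)
open import Data.Sum using (inj₁; inj₂)
open import Relation.Binary.PropositionalEquality using (refl) renaming (sym to ≡-sym)

record Graph (N : ℕ) : Set₁ where
  field
    Adj   : Fin N → Fin N → Set
    sym   : ∀ {u v} → Adj u v → Adj v u
    irrefl : ∀ {u} → ¬ Adj u u
open Graph public

Proper : ∀ {N} → Graph N → (k : ℕ) → (Fin N → Fin k) → Set
Proper G k c = ∀ u v → Adj G u v → c u ≢ c v

Orthogonal : ∀ {N k} → (Fin N → Fin k) → (Fin N → Fin k) → Set
Orthogonal c₁ c₂ = ∀ u v → u ≢ v → c₁ u ≡ c₁ v → c₂ u ≢ c₂ v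

OrthColouring : ∀ {N} → Graph N → ℕ → Set
OrthColouring {N} G k =
  Σ (Fin N → Fin k) λ c₁ → Σ (Fin N → Fin k) λ c₂ →
    Proper G k c₁ × Proper G k c₂ × Orthogonal c₁ c₂

OChiIs : ∀ {N} → Graph N → ℕ → Set
OChiIs G k = OrthColouring G k × (∀ j → j < k → ¬ OrthColouring G j)

-- Cartesian product G □ H on Fin (N * M); vertex (u , v) is encoded as combine u v.
-- (u₁,v₁) ~ (u₂,v₂) iff (u₁ = u₂ and v₁v₂ ∈ E(H)) or (v₁ = v₂ and u₁u₂ ∈ E(G)).
CartAdj : ∀ {N M} → Graph N → Graph M → Fin (N * M) → Fin (N * M) → Set
CartAdj {N} {M} G H x y =
  let (u₁ , v₁) = remQuot {N} M x
      (u₂ , v₂) = remQuot {N} M y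
  in (u₁ ≡ u₂ × Adj H v₁ v₂) ⊎ (v₁ ≡ v₂ × Adj G u₁ u₂)

_□_ : ∀ {N M} → Graph N → Graph M → Graph (N * M)
_□_ {N} {M} G H = record
  { Adj = CartAdj G H
  ; sym = λ { (inj₁ (e , a)) → inj₁ (≡-sym e , Graph.sym H a)
            ; (inj₂ (e , a)) → inj₂ (≡-sym e , Graph.sym G a) }
  ; irrefl = λ { (inj₁ (_ , a)) → Graph.irrefl H a
               ; (inj₂ (_ , a)) → Graph.irrefl G a } }

-- Lower bound: if c₁, c₂ is an orthogonal colouring with k colours, then x ↦ (c₁ x , c₂ x) is
-- injective, so a graph with more than k² vertices has none; G □ H has (nm)² vertices.
-- Upper bound: write a vertex of H as (p , q) ∈ ℤₘ² and colour (u , (p , q)) of G □ H by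
-- (c₁ u + p , q) and (c₂ u + q , p) in ℤₙ × ℤₘ, where c₁, c₂ is an orthogonal colouring of G
-- with n colours. Since m ≤ n, the shift c ↦ c + p is injective in p as well as in c, which
-- makes both colourings proper and orthogonal.
module Submission where

open import Defs
open import Data.Nat using (ℕ; suc; _+_; _∸_; _*_; _%_; _<_; _≤_; _≥_; NonZero)
open import Data.Nat.Properties using (+-comm; +-assoc; m+[n∸m]≡n; <⇒≤; *-mono-<; [m*n]*[o*p]≡[m*o]*[n*p])
open import Data.Nat.DivMod using (m%n<n; %-distribˡ-+; [m+n]%n≡m%n; m<n⇒m%n≡m)
open import Data.Fin using (Fin; toℕ; fromℕ<; inject≤; combine; remQuot; _≟_)
open import Data.Fin.Properties
  using (toℕ-injective; toℕ<n; toℕ-fromℕ<; fromℕ<-cong; inject≤-injective; combine-injective; combine-remQuot; pigeonhole; <⇒≢)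
open import Data.Product using (_×_; _,_; proj₁; proj₂; uncurry)
open import Data.Sum using (_⊎_; inj₁; inj₂)
open import Data.Empty using (⊥-elim)
open import Function using (_∘_; flip)
open import Function.Definitions using (Injective)
open import Relation.Nullary using (¬_; yes; no)
open import Relation.Binary.PropositionalEquality
  using (_≡_; _≢_; refl; trans; cong; cong₂; subst; module ≡-Reasoning)
  renaming (sym to ≡-sym)

%-+-cancelʳ : ∀ {n} .{{_ : NonZero n}} {k x y} → k ≤ n → x < n → y < n →
              (x + k) % n ≡ (y + k) % n → x ≡ y
%-+-cancelʳ {n} {k} {x} {y} k≤n x<n y<n eq = begin
  x                               ≡⟨ undo x<n ⟨
  ((x + k) % n + (n ∸ k) % n) % n ≡⟨ cong (λ r → (r + (n ∸ k) % n) % n) eq ⟩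
  ((y + k) % n + (n ∸ k) % n) % n ≡⟨ undo y<n ⟩
  y                               ∎
  where
  open ≡-Reasoning
  undo : ∀ {z} → z < n → ((z + k) % n + (n ∸ k) % n) % n ≡ z
  undo {z} z<n = begin
    ((z + k) % n + (n ∸ k) % n) % n ≡⟨ %-distribˡ-+ (z + k) (n ∸ k) n ⟨
    (z + k + (n ∸ k)) % n           ≡⟨ cong (_% n) (+-assoc z k (n ∸ k)) ⟩
    (z + (k + (n ∸ k))) % n         ≡⟨ cong (λ r → (z + r) % n) (m+[n∸m]≡n k≤n) ⟩
    (z + n) % n                     ≡⟨ [m+n]%n≡m%n z n ⟩
    z % n                           ≡⟨ m<n⇒m%n≡m z<n ⟩
    z                               ∎

infixl 6 _⊕_

_⊕_ : ∀ {n} → Fin n → Fin n → Fin n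
_⊕_ {suc n} a b = fromℕ< (m%n<n (toℕ a + toℕ b) (suc n))

⊕-comm : ∀ {n} (a b : Fin n) → a ⊕ b ≡ b ⊕ a
⊕-comm {suc n} a b = fromℕ<-cong _ _ (cong (_% suc n) (+-comm (toℕ a) (toℕ b))) _ _

⊕-cancelʳ : ∀ {n} (a b c : Fin n) → a ⊕ c ≡ b ⊕ c → a ≡ b
⊕-cancelʳ {suc n} a b c eq = toℕ-injective (%-+-cancelʳ (<⇒≤ (toℕ<n c)) (toℕ<n a) (toℕ<n b) (begin
  (toℕ a + toℕ c) % suc n ≡⟨ toℕ-fromℕ< _ ⟨
  toℕ (a ⊕ c)             ≡⟨ cong toℕ eq ⟩
  toℕ (b ⊕ c)             ≡⟨ toℕ-fromℕ< _ ⟩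
  (toℕ b + toℕ c) % suc n ∎))
  where open ≡-Reasoning

⊕-cancelˡ : ∀ {n} (a b c : Fin n) → c ⊕ a ≡ c ⊕ b → a ≡ b
⊕-cancelˡ a b c eq = ⊕-cancelʳ a b c (trans (⊕-comm a c) (trans eq (⊕-comm c b)))

JointlyInjective : ∀ {A B C : Set} → (A → B) → (A → C) → Set
JointlyInjective f g = ∀ x y → f x ≡ f y → g x ≡ g y → x ≡ y

orthogonal⇒jointlyInjective : ∀ {N k} {c₁ c₂ : Fin N → Fin k} → Orthogonal c₁ c₂ → JointlyInjective c₁ c₂
orthogonal⇒jointlyInjective orth x y e₁ e₂ with x ≟ y
... | yes x≡y = x≡y
... | no x≢y  = ⊥-elim (orth x y x≢y e₁ e₂)

jointlyInjective⇒orthogonal : ∀ {N k} {c₁ c₂ : Fin N → Fin k} → JointlyInjective c₁ c₂ → Orthogonal c₁ c₂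
jointlyInjective⇒orthogonal inj x y x≢y e₁ e₂ = x≢y (inj x y e₁ e₂)

jointlyInjective-∘ : ∀ {A B C D : Set} {f : B → C} {g : B → D} {h : A → B} →
                     Injective _≡_ _≡_ h → JointlyInjective f g → JointlyInjective (f ∘ h) (g ∘ h)
jointlyInjective-∘ h-inj fg-inj x y e₁ e₂ = h-inj (fg-inj _ _ e₁ e₂)

remQuot-injective : ∀ {N} M → Injective _≡_ _≡_ (remQuot {N} M)
remQuot-injective {N} M {x} {y} eq =
  trans (≡-sym (combine-remQuot {N} M x)) (trans (cong (uncurry combine) eq) (combine-remQuot {N} M y))

few-colours⇒¬OrthColouring : ∀ {N} (G : Graph N) k → k * k < N → ¬ OrthColouring G k
few-colours⇒¬OrthColouring G k k²<N (c₁ , c₂ , _ , _ , orth) =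
  let i , j , i<j , eq = pigeonhole k²<N (λ x → combine (c₁ x) (c₂ x))
  in <⇒≢ i<j (uncurry (orthogonal⇒jointlyInjective orth i j) (combine-injective _ _ _ _ eq))

module _ {N M n m : ℕ} (G : Graph N) (H : Graph M) (m≤n : m ≤ n) where

  shiftColour : (Fin N → Fin n) → (Fin M → Fin m) → (Fin M → Fin m) → Fin N → Fin M → Fin (n * m)
  shiftColour c d d′ u v = combine (c u ⊕ inject≤ (d v) m≤n) (d′ v)

  shiftColour-proper : ∀ {c d d′} → Proper G n c → JointlyInjective d d′ →
    ∀ u u′ v v′ → (u ≡ u′ × Adj H v v′) ⊎ (v ≡ v′ × Adj G u u′) →
    shiftColour c d d′ u v ≢ shiftColour c d d′ u′ v′
  shiftColour-proper {c} _ dd′-inj u .u v v′ (inj₁ (refl , v~v′)) eq =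
    let shift≡ , d′≡ = combine-injective _ _ _ _ eq
        d≡ = inject≤-injective _ _ _ _ (⊕-cancelˡ _ _ (c u) shift≡)
    in irrefl H (subst (Adj H v) (≡-sym (dd′-inj v v′ d≡ d′≡)) v~v′)
  shiftColour-proper c-proper _ u u′ v .v (inj₂ (refl , u~u′)) eq =
    c-proper u u′ u~u′ (⊕-cancelʳ _ _ _ (proj₁ (combine-injective _ _ _ _ eq)))

  shiftColours-jointlyInjective : ∀ {c₁ c₂ d₁ d₂} → JointlyInjective c₁ c₂ → JointlyInjective d₁ d₂ →
    JointlyInjective (uncurry (shiftColour c₁ d₁ d₂)) (uncurry (shiftColour c₂ d₂ d₁))
  shiftColours-jointlyInjective {c₁} {c₂} {d₁} {d₂} c-inj d-inj (u , v) (u′ , v′) e₁ e₂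
    with combine-injective _ _ _ _ e₁ | combine-injective _ _ _ _ e₂
  ... | shift₁≡ , d₂≡ | shift₂≡ , d₁≡ with d-inj v v′ d₁≡ d₂≡
  ... | refl = cong (_, v) (c-inj u u′ (⊕-cancelʳ _ _ _ shift₁≡) (⊕-cancelʳ _ _ _ shift₂≡))

  □-orthColouring : OrthColouring G n → (d₁ d₂ : Fin M → Fin m) → JointlyInjective d₁ d₂ →
                    OrthColouring (G □ H) (n * m)
  □-orthColouring (c₁ , c₂ , c₁-proper , c₂-proper , c-orth) d₁ d₂ d-inj =
    uncurry (shiftColour c₁ d₁ d₂) ∘ remQuot M ,
    uncurry (shiftColour c₂ d₂ d₁) ∘ remQuot M ,
    (λ _ _ → shiftColour-proper c₁-proper d-inj _ _ _ _) ,
    (λ _ _ → shiftColour-proper c₂-proper (λ v v′ → flip (d-inj v v′)) _ _ _ _) ,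
    jointlyInjective⇒orthogonal (jointlyInjective-∘ (remQuot-injective {N} M)
      (shiftColours-jointlyInjective (orthogonal⇒jointlyInjective c-orth) d-inj))

theorem13 : (n m : ℕ) → n ≥ m → (G : Graph (n * n)) → (H : Graph (m * m)) →
    OChiIs G n → OChiIs (G □ H) (n * m)
theorem13 n m m≤n G H (G-orth , _) =
  □-orthColouring G H m≤n G-orth (proj₁ ∘ remQuot {m} m) (proj₂ ∘ remQuot {m} m) coordinates-injective ,
  λ k k<nm → few-colours⇒¬OrthColouring (G □ H) k
    (subst (k * k <_) ([m*n]*[o*p]≡[m*o]*[n*p] n m n m) (*-mono-< k<nm k<nm))
  where
  coordinates-injective : JointlyInjective (proj₁ ∘ remQuot {m} m) (proj₂ ∘ remQuot {m} m)
  coordinates-injective = jointlyInjective-∘ (remQuot-injective {m} m) (λ _ _ → cong₂ _,_)
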